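{- Let $(\mathcal{C},\Omega,\mathfrak{P})$ be a measurable spined category, and let $\Delta(X)$ (resp. $\Delta^{ch}(X)$) be the minimum width of a pseudo-chordal (resp. chordal) completion of $X$. Then $\Delta$ and $\Delta^{ch}$ are functors from $\mathcal{C}$ to the poset $(\mathbb{N},\le)$; that is, whenever there is a morphism $X\to Y$ in $\mathcal{C}$, we have $\Delta(X)\le\Delta(Y)$ and $\Delta^{ch}(X)\le\Delta^{ch}(Y)$.
   Context: A spined category is a triple $(\mathcal{C},\Omega,\mathfrak{P})$: a category $\mathcal{C}$, a sequence of objects $(\Omega_n)_{n\in\mathbb{N}}$, and an operation $\mathfrak{P}$ assigning to each span $G\xleftarrow{g}\Omega_n\xrightarrow{h}H$ an object $\mathfrak{P}(g,h)$ and morphisms $\mathfrak{P}(g,h)_g:G\to\mathfrak{P}(g,h)$, $\mathfrak{P}(g,h)_h:H\to\mathfrak{P}(g,h)$ with $\mathfrak{P}(g,h)_gg=\mathfrak{P}(g,h)_hh$, such that (SC1) every object has a morphism to some $\Omega_n$; (SC2) for every such span and all $g':G\to G'$, $h':H\to H'$ there is a unique morphism $(g',h'):\mathfrak{P}(g,h)\to\mathfrak{P}(g'g,h'h)$ with $(g',h')\mathfrak{P}(g,h)_g=\mathfrak{P}(g'g,h'h)_{g'g}g'$ and $(g',h')\mathfrak{P}(g,h)_h=\mathfrak{P}(g'g,h'h)_{h'h}h'$. An S-functor is a functor $F$ to the poset $(\mathbb{N},\le)$ with $F(\Omega_n)=n$ and $F(\mathfrak{P}(g,h))=\max\{F(G),F(H)\}$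 for every span; measurable means one exists. An object is pseudo-chordal if all S-functors agree on it. Chordal objects: the smallest set $S$ containing all $\Omega_n$ and containing $\mathfrak{P}(a,b)$ whenever $A,B\in S$, $a:\Omega_n\to A$, $b:\Omega_n\to B$. A pseudo-chordal (resp. chordal) completion of $X$ is a morphism $\delta:X\to H$ with $H$ pseudo-chordal (resp. chordal); its width is $F(H)$ for any S-functor $F$. -}

module Defs where

open import Level using (Level)
open import Data.Nat using (ℕ; _≤_; _⊔_)
open import Data.Product using (Σ; _×_; _,_; proj₁)
open import Relation.Binary.PropositionalEquality using (_≡_)

record Category (o ℓ : Level) : Set (Level.suc (o Level.⊔ ℓ)) where
  infixr 9 _∘_
  field
    Obj  : Set o
    Hom  : Obj → Obj → Set ℓ
    id   : ∀ {A} → Hom A A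
    _∘_  : ∀ {A B C} → Hom B C → Hom A B → Hom A C
    identityˡ : ∀ {A B} (f : Hom A B) → id ∘ f ≡ f
    identityʳ : ∀ {A B} (f : Hom A B) → f ∘ id ≡ f
    assoc : ∀ {A B C D} (f : Hom C D) (g : Hom B C) (h : Hom A B) →
            (f ∘ g) ∘ h ≡ f ∘ (g ∘ h)

record SpinedCategory (o ℓ : Level) : Set (Level.suc (o Level.⊔ ℓ)) where
  field
    cat : Category o ℓ
  open Category cat public
  field
    Ω  : ℕ → Obj
    𝔓  : ∀ {n G H} → Hom (Ω n) G → Hom (Ω n) H → Obj
    𝔓ₗ : ∀ {n G H} (g : Hom (Ω n) G) (h : Hom (Ω n) H) → Hom G (𝔓 g h)
    𝔓ᵣ : ∀ {n G H} (g : Hom (Ω n) G) (h : Hom (Ω n) H) → Hom H (𝔓 g h)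
    𝔓-comm : ∀ {n G H} (g : Hom (Ω n) G) (h : Hom (Ω n) H) →
             𝔓ₗ g h ∘ g ≡ 𝔓ᵣ g h ∘ h
    SC1 : ∀ X → Σ ℕ (λ n → Hom X (Ω n))
    𝔓map : ∀ {n G H G' H'} (g : Hom (Ω n) G) (h : Hom (Ω n) H)
           (g' : Hom G G') (h' : Hom H H') →
           Hom (𝔓 g h) (𝔓 (g' ∘ g) (h' ∘ h))
    𝔓map-ₗ : ∀ {n G H G' H'} (g : Hom (Ω n) G) (h : Hom (Ω n) H)
             (g' : Hom G G') (h' : Hom H H') →
             𝔓map g h g' h' ∘ 𝔓ₗ g h ≡ 𝔓ₗ (g' ∘ g) (h' ∘ h) ∘ g'
    𝔓map-ᵣ : ∀ {n G H G' H'} (g : Hom (Ω n) G) (h : Hom (Ω n) H)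
             (g' : Hom G G') (h' : Hom H H') →
             𝔓map g h g' h' ∘ 𝔓ᵣ g h ≡ 𝔓ᵣ (g' ∘ g) (h' ∘ h) ∘ h'
    𝔓map-unique : ∀ {n G H G' H'} (g : Hom (Ω n) G) (h : Hom (Ω n) H)
                  (g' : Hom G G') (h' : Hom H H')
                  (u : Hom (𝔓 g h) (𝔓 (g' ∘ g) (h' ∘ h))) →
                  u ∘ 𝔓ₗ g h ≡ 𝔓ₗ (g' ∘ g) (h' ∘ h) ∘ g' →
                  u ∘ 𝔓ᵣ g h ≡ 𝔓ᵣ (g' ∘ g) (h' ∘ h) ∘ h' →
                  u ≡ 𝔓map g h g' h'

module _ {o ℓ : Level} (𝒮 : SpinedCategory o ℓ) where
  open SpinedCategory 𝒮

  record IsFunctorToℕ (F : Obj → ℕ) : Set (o Level.⊔ ℓ) where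
    field
      mono : ∀ {X Y} → Hom X Y → F X ≤ F Y

  record IsSFunctor (F : Obj → ℕ) : Set (o Level.⊔ ℓ) where
    field
      functor : IsFunctorToℕ F
      on-Ω    : ∀ n → F (Ω n) ≡ n
      on-𝔓    : ∀ {n G H} (g : Hom (Ω n) G) (h : Hom (Ω n) H) →
                F (𝔓 g h) ≡ F G ⊔ F H

  SFunctor : Set (o Level.⊔ ℓ)
  SFunctor = Σ (Obj → ℕ) IsSFunctor

  Measurable : Set (o Level.⊔ ℓ)
  Measurable = SFunctor

  PseudoChordal : Obj → Set (o Level.⊔ ℓ)
  PseudoChordal X = (F F' : SFunctor) →
    proj₁ F X ≡ proj₁ F' X

  data Chordal : Obj → Set (o Level.⊔ ℓ) where
    Ω-chordal : ∀ n → Chordal (Ω n)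
    𝔓-chordal : ∀ {n A B} (a : Hom (Ω n) A) (b : Hom (Ω n) B) →
                Chordal A → Chordal B → Chordal (𝔓 a b)

  -- d is the minimum width (measured with the S-functor F) of a
  -- completion X → H with H satisfying P.
  IsMinWidth : (P : Obj → Set (o Level.⊔ ℓ)) → SFunctor → Obj → ℕ →
               Set (o Level.⊔ ℓ)
  IsMinWidth P (F , _) X d =
    Σ Obj (λ H → Hom X H × P H × F H ≡ d) ×
    (∀ H → Hom X H → P H → d ≤ F H)

  IsΔ : SFunctor → Obj → ℕ → Set (o Level.⊔ ℓ)
  IsΔ = IsMinWidth PseudoChordal

  IsΔch : SFunctor → Obj → ℕ → Set (o Level.⊔ ℓ)
  IsΔch = IsMinWidth Chordal

module Submission where

open import Defs
open import Level using (Level; _⊔_)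
open import Data.Nat using (ℕ; _≤_)
open import Data.Product using (_×_; _,_)
open import Relation.Binary.PropositionalEquality using (subst)

-- Precomposing an optimal completion of Y with X → Y yields a completion of
-- X of the same width, which the minimality at X bounds from below.
IsMinWidth-mono : {o ℓ : Level} (𝒮 : SpinedCategory o ℓ)
  (P : SpinedCategory.Obj 𝒮 → Set (o ⊔ ℓ)) (F : SFunctor 𝒮)
  {X Y : SpinedCategory.Obj 𝒮} → SpinedCategory.Hom 𝒮 X Y →
  (d e : ℕ) → IsMinWidth 𝒮 P F X d → IsMinWidth 𝒮 P F Y e → d ≤ e
IsMinWidth-mono 𝒮 P F f d e (_ , minimalX) ((H , g , PH , FH≡e) , _) =
  subst (d ≤_) FH≡e (minimalX H (g ∘ f) PH)
  where open SpinedCategory 𝒮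

proposition4p8 : {o ℓ : Level} (𝒮 : SpinedCategory o ℓ) →
    (F : SFunctor 𝒮) →
    (X Y : SpinedCategory.Obj 𝒮) → SpinedCategory.Hom 𝒮 X Y →
    ((d e : ℕ) → IsΔ 𝒮 F X d → IsΔ 𝒮 F Y e → d ≤ e) ×
    ((d e : ℕ) → IsΔch 𝒮 F X d → IsΔch 𝒮 F Y e → d ≤ e)
proposition4p8 𝒮 F X Y f =
  IsMinWidth-mono 𝒮 (PseudoChordal 𝒮) F f ,
  IsMinWidth-mono 𝒮 (Chordal 𝒮) F f
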